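{- Let $n\ge 1$ and let $G$ be a $2n$-regular graph on $m$ vertices having a distance magic labeling $f$. Suppose $G$ contains a subgraph $H$ isomorphic to $H_{2n-2,2n}$ (i.e. to $K_{2n}$ minus a perfect matching) such that for every pair of twin vertices $\{x,x'\}$ of $H$ (the $n$ pairs of vertices of $H$ that are non-adjacent in $H$) one has $f(x)+f(x')=m+1$. Let $G^{\dagger}$ be the graph obtained from $G$ by deleting all edges of $H$ and adding a set $U$ of $2n-2$ new vertices, each joined to every vertex of $H$. Then $G^{\dagger}$ is a $2n$-regular distance magic graph on $m+2n-2$ vertices; in particular, such a graph exists.
   Context: All graphs are finite and simple. A distance magic labeling of a graph $G$ on $N$ vertices is a bijection $f:V(G)\to\{1,\dots,N\}$ such that $w_G(u)=\sum_{v\in N_G(u)}f(v)$ is the same constant for all vertices $u$; $G$ is distance magic if it has one. $H_{2n-2,2n}$ denotes the graph on vertices $v_0,\dots,v_{2n-1}$ in which $v_i\sim v_j$ iff $i\ne j$ and $j\not\equiv i+n \pmod{2n}$; it is isomorphic to $K_{2n}$ minus a perfect matching. -}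

module Defs where

open import Data.Nat using (ℕ; zero; suc; _+_; _∸_; _≡ᵇ_)
open import Data.Nat.DivMod using (_%_)

open import Data.Fin using (Fin; zero; suc; toℕ; splitAt)
import Data.Fin.Properties as FinP
open import Data.Bool using (Bool; true; false; _∧_; not; if_then_else_)
open import Data.Sum using (_⊎_; inj₁; inj₂)
open import Data.Maybe using (Maybe; just; nothing; is-just)
import Data.Maybe as Maybe
open import Data.Product using (Σ; ∃; _×_)
open import Relation.Binary.PropositionalEquality using (_≡_)
open import Relation.Nullary.Decidable using (⌊_⌋)
open import Function.Bundles using (_⤖_; Bijection)
open import Function.Base using (_∘_)

Adj : ℕ → Set
Adj N = Fin N → Fin N → Bool

IsSimple : ∀ {N} → Adj N → Set
IsSimple {N} a = (∀ u v → a u v ≡ a v u) × (∀ u → a u u ≡ false)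

sumFin : ∀ {k} → (Fin k → ℕ) → ℕ
sumFin {zero}  g = 0
sumFin {suc k} g = g zero + sumFin (g ∘ suc)

degree : ∀ {N} → Adj N → Fin N → ℕ
degree a u = sumFin (λ v → if a u v then 1 else 0)

Regular : ∀ {N} → ℕ → Adj N → Set
Regular r a = ∀ u → degree a u ≡ r

-- Labeling f : V → {1..N}, represented by a bijection Fin N ⤖ Fin N, label = toℕ + 1.
label : ∀ {N} → (Fin N ⤖ Fin N) → Fin N → ℕ
label f v = suc (toℕ (Bijection.to f v))

weight : ∀ {N} → Adj N → (Fin N → ℕ) → Fin N → ℕ
weight a ℓ u = sumFin (λ v → if a u v then ℓ v else 0)

IsDistanceMagicLabeling : ∀ {N} → Adj N → (Fin N ⤖ Fin N) → Set
IsDistanceMagicLabeling a f = ∃ λ c → ∀ u → weight a (label f) u ≡ c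

DistanceMagic : ∀ {N} → Adj N → Set
DistanceMagic {N} a = Σ (Fin N ⤖ Fin N) (IsDistanceMagicLabeling a)

hAdj : (n : ℕ) → Fin (n + n) → Fin (n + n) → Bool
hAdj zero    i j = false
hAdj (suc k) i j =
  not ⌊ i FinP.≟ j ⌋ ∧ not (toℕ j ≡ᵇ ((toℕ i + suc k) % (suc k + suc k)))

preimage : ∀ {k m} → (Fin k → Fin m) → Fin m → Maybe (Fin k)
preimage {zero}  φ u = nothing
preimage {suc k} φ u =
  if ⌊ φ zero FinP.≟ u ⌋ then just zero else Maybe.map suc (preimage (φ ∘ suc) u)

inH : ∀ {m} (n : ℕ) → (Fin (n + n) → Fin m) → Fin m → Fin m → Bool
inH n φ u v with preimage φ u | preimage φ v
... | just i | just j = hAdj n i j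
... | _      | _      = false

dagger : ∀ {m} (n : ℕ) → Adj m → (Fin (n + n) → Fin m) → Adj (m + (n + n ∸ 2))
dagger {m} n a φ x y with splitAt m x | splitAt m y
... | inj₁ u | inj₁ v = a u v ∧ not (inH n φ u v)
... | inj₁ u | inj₂ _ = is-just (preimage φ u)
... | inj₂ _ | inj₁ v = is-just (preimage φ v)
... | inj₂ _ | inj₂ _ = false

-- Let p = n - 1 and s = m + 2p + 1, one more than the number of vertices of G†. Double counting
-- shows that a 2n-regular distance magic graph on m vertices has magic constant n(m + 1).
-- Label G† by moving every old label up by p and giving the 2p new vertices the p smallest and
-- the p largest labels. An old vertex outside H keeps its neighbourhood, so its weight becomes
-- n(m + 1) + 2np = ns; a new vertex is adjacent exactly to H, whose labels form n twin pairs of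
-- sum s each, so its weight is ns as well. A vertex of H loses its H-neighbours, whose labels sum
-- to ns minus the label sum s of its own twin pair, that is ps, and gains the new vertices, whose
-- labels also sum to ps. Degrees are the same computation with every label equal to 1.

module Submission where

open import Defs
open import Data.Nat using (ℕ; zero; suc; _+_; _*_; _≤_; _∸_; _≡ᵇ_; NonZero; s≤s; z≤n)
open import Data.Nat.DivMod using (_%_; m<n⇒m%n≡m; [m+n]%n≡m%n)
open import Data.Nat.Properties
open import Data.Nat.Tactic.RingSolver using (solve-∀)
open import Algebra.Properties.CommutativeMonoid.Sum +-0-commutativeMonoid using (sum; ∑-distrib-+; ∑-comm)
open import Data.Fin using (Fin; zero; suc; toℕ; _↑ˡ_; _↑ʳ_; splitAt; join; cast)
import Data.Fin.Properties as Fin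
open import Data.Bool using (true; false; _∧_; not; if_then_else_)
import Data.Bool.Properties as Bool
open import Data.Maybe using (just; nothing; maybe′; is-just)
import Data.Maybe as Maybe
open import Data.Product using (∃; _×_; _,_)
open import Data.Sum using (_⊎_; inj₁; inj₂; swap)
open import Data.Sum.Properties using (swap-involutive)
open import Data.Sum.Algebra using (⊎-assoc; ⊎-comm)
open import Data.Sum.Function.Propositional using (_⊎-↔_)
open import Function.Base using (_∘_)
open import Function.Definitions using (Injective)
open import Function.Bundles using (_⤖_; _↔_; _⇔_; Bijection; mk⇔; mk↔ₛ′)
open import Function.Construct.Identity using (↔-id)
open import Function.Properties.Bijection using (⤖⇒↔)
open import Function.Properties.Inverse using (↔⇒⤖)
open import Function.Related.Propositional using (module EquationalReasoning)
open import Relation.Binary.PropositionalEquality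
open import Relation.Nullary using (Dec; yes; no; contradiction)
open import Relation.Nullary.Decidable using (⌊_⌋; ⌊⌋-map′; does-⇔; isYes≗does)

sumFin≡sum : ∀ {k} (g : Fin k → ℕ) → sumFin g ≡ sum g
sumFin≡sum {zero}  g = refl
sumFin≡sum {suc k} g = cong (g zero +_) (sumFin≡sum (g ∘ suc))

sumFin-cong : ∀ {k} {g h : Fin k → ℕ} → (∀ i → g i ≡ h i) → sumFin g ≡ sumFin h
sumFin-cong {zero}  eq = refl
sumFin-cong {suc k} eq = cong₂ _+_ (eq zero) (sumFin-cong (eq ∘ suc))

sumFin-distrib-+ : ∀ {k} (g h : Fin k → ℕ) → sumFin (λ i → g i + h i) ≡ sumFin g + sumFin h
sumFin-distrib-+ g h = begin
  sumFin (λ i → g i + h i) ≡⟨ sumFin≡sum (λ i → g i + h i) ⟩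
  sum (λ i → g i + h i)    ≡⟨ ∑-distrib-+ g h ⟩
  sum g + sum h            ≡⟨ cong₂ _+_ (sumFin≡sum g) (sumFin≡sum h) ⟨
  sumFin g + sumFin h      ∎
  where open ≡-Reasoning

sumFin-comm : ∀ {k l} (g : Fin k → Fin l → ℕ) →
              sumFin (λ i → sumFin (g i)) ≡ sumFin (λ j → sumFin (λ i → g i j))
sumFin-comm g = begin
  sumFin (λ i → sumFin (g i))              ≡⟨ trans (sumFin-cong (sumFin≡sum ∘ g)) (sumFin≡sum (λ i → sum (g i))) ⟩
  sum (λ i → sum (g i))                    ≡⟨ ∑-comm g ⟩
  sum (λ j → sum (λ i → g i j))            ≡⟨ trans (sumFin-cong (λ j → sumFin≡sum (λ i → g i j))) (sumFin≡sum (λ j → sum (λ i → g i j))) ⟨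
  sumFin (λ j → sumFin (λ i → g i j))      ∎
  where open ≡-Reasoning

sumFin-const : ∀ k c → sumFin {k} (λ _ → c) ≡ k * c
sumFin-const zero    c = refl
sumFin-const (suc k) c = cong (c +_) (sumFin-const k c)

sumFin-zero : ∀ k → sumFin {k} (λ _ → 0) ≡ 0
sumFin-zero k = trans (sumFin-const k 0) (*-zeroʳ k)

sumFin-*ʳ : ∀ {k} (g : Fin k → ℕ) c → sumFin (λ i → g i * c) ≡ sumFin g * c
sumFin-*ʳ {zero}  g c = refl
sumFin-*ʳ {suc k} g c =
  trans (cong (g zero * c +_) (sumFin-*ʳ (g ∘ suc) c)) (sym (*-distribʳ-+ c (g zero) _))

sumFin-↑ : ∀ k l (g : Fin (k + l) → ℕ) →
           sumFin g ≡ sumFin (λ i → g (i ↑ˡ l)) + sumFin (λ j → g (k ↑ʳ j))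
sumFin-↑ zero    l g = refl
sumFin-↑ (suc k) l g = trans (cong (g zero +_) (sumFin-↑ k l (g ∘ suc))) (sym (+-assoc (g zero) _ _))

sumFin-if : ∀ {k} b (g : Fin k → ℕ) → sumFin (λ i → if b then g i else 0) ≡ (if b then sumFin g else 0)
sumFin-if {k} true  g = refl
sumFin-if {k} false g = sumFin-zero k

sumFin-indicator : ∀ {k} (a : Fin k) (g : Fin k → ℕ) → sumFin (λ i → if ⌊ a Fin.≟ i ⌋ then g i else 0) ≡ g a
sumFin-indicator {suc k} zero    g = trans (cong (g zero +_) (sumFin-zero k)) (+-identityʳ _)
sumFin-indicator {suc k} (suc a) g = trans
  (sumFin-cong (λ i → cong (λ b → if b then g (suc i) else 0) (⌊⌋-map′ (cong suc) Fin.suc-injective (a Fin.≟ i))))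
  (sumFin-indicator a (g ∘ suc))

sumFin-triangular : ∀ k → sumFin {k} (suc ∘ toℕ) + sumFin {k} (suc ∘ toℕ) ≡ k * suc k
sumFin-triangular zero = refl
sumFin-triangular (suc k) = begin
  T′ + T′                       ≡⟨ cong (λ t → suc t + suc t) (sumFin-distrib-+ {k} (λ _ → 1) (suc ∘ toℕ)) ⟩
  suc (S + T) + suc (S + T)     ≡⟨ cong (λ s → suc (s + T) + suc (s + T)) (trans (sumFin-const k 1) (*-identityʳ k)) ⟩
  suc (k + T) + suc (k + T)     ≡⟨ regroup k T ⟩
  2 * suc k + (T + T)           ≡⟨ cong (2 * suc k +_) (sumFin-triangular k) ⟩
  2 * suc k + k * suc k         ≡⟨ *-distribʳ-+ (suc k) 2 k ⟨
  (2 + k) * suc k               ≡⟨ *-comm (2 + k) (suc k) ⟩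
  suc k * suc (suc k)           ∎
  where
  open ≡-Reasoning
  T′ = sumFin {suc k} (suc ∘ toℕ)
  T = sumFin {k} (suc ∘ toℕ)
  S = sumFin {k} (λ _ → 1)
  regroup : ∀ k t → suc (k + t) + suc (k + t) ≡ 2 * suc k + (t + t)
  regroup = solve-∀

module _ {m : ℕ} where

  preimage-sound : ∀ {k} (φ : Fin k → Fin m) {v i} → preimage φ v ≡ just i → φ i ≡ v
  preimage-sound {suc k} φ {v} eq with φ zero Fin.≟ v | preimage (φ ∘ suc) v in e
  preimage-sound {suc k} φ refl | yes φ0≡v | _      = φ0≡v
  preimage-sound {suc k} φ refl | no _     | just j = preimage-sound (φ ∘ suc) e

  preimage-complete : ∀ {k} (φ : Fin k → Fin m) i → ∃ λ j → preimage φ (φ i) ≡ just j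
  preimage-complete {suc k} φ i with φ zero Fin.≟ φ i
  preimage-complete {suc k} φ i       | yes _ = zero , refl
  preimage-complete {suc k} φ zero    | no φ0≢φ0 = contradiction refl φ0≢φ0
  preimage-complete {suc k} φ (suc i) | no _ with preimage-complete (φ ∘ suc) i
  ... | j , eq = suc j , cong (Maybe.map suc) eq

  preimage-injective : ∀ {k} (φ : Fin k → Fin m) → Injective _≡_ _≡_ φ → ∀ i → preimage φ (φ i) ≡ just i
  preimage-injective φ φ-inj i with preimage-complete φ i
  ... | j , eq = trans eq (cong just (φ-inj (preimage-sound φ eq)))

  sumFin-preimage : ∀ {k} (φ : Fin k → Fin m) → Injective _≡_ _≡_ φ → (h : Fin k → Fin m → ℕ) →
    sumFin (λ v → maybe′ (λ i → h i v) 0 (preimage φ v)) ≡ sumFin (λ i → h i (φ i))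
  sumFin-preimage {zero}  φ φ-inj h = sumFin-zero m
  sumFin-preimage {suc k} φ φ-inj h = begin
    sumFin (λ v → maybe′ (λ i → h i v) 0 (preimage φ v))
      ≡⟨ sumFin-cong peel ⟩
    sumFin (λ v → (if ⌊ φ zero Fin.≟ v ⌋ then h zero v else 0) + maybe′ (λ i → h (suc i) v) 0 (preimage (φ ∘ suc) v))
      ≡⟨ sumFin-distrib-+ (λ v → if ⌊ φ zero Fin.≟ v ⌋ then h zero v else 0) _ ⟩
    sumFin (λ v → if ⌊ φ zero Fin.≟ v ⌋ then h zero v else 0) + sumFin (λ v → maybe′ (λ i → h (suc i) v) 0 (preimage (φ ∘ suc) v))
      ≡⟨ cong₂ _+_ (sumFin-indicator (φ zero) (h zero)) (sumFin-preimage (φ ∘ suc) (Fin.suc-injective ∘ φ-inj) (h ∘ suc)) ⟩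
    h zero (φ zero) + sumFin (λ i → h (suc i) (φ (suc i))) ∎
    where
    open ≡-Reasoning
    peel : ∀ v → maybe′ (λ i → h i v) 0 (preimage φ v) ≡
                 (if ⌊ φ zero Fin.≟ v ⌋ then h zero v else 0) + maybe′ (λ i → h (suc i) v) 0 (preimage (φ ∘ suc) v)
    peel v with φ zero Fin.≟ v | preimage (φ ∘ suc) v in e
    ... | yes refl | just i  = contradiction (φ-inj (preimage-sound (φ ∘ suc) e)) (λ ())
    ... | yes refl | nothing = sym (+-identityʳ _)
    ... | no _     | just i  = refl
    ... | no _     | nothing = refl

  sumFin-bijection : (f : Fin m ⤖ Fin m) (g : Fin m → ℕ) → sumFin (g ∘ Bijection.to f) ≡ sumFin g
  sumFin-bijection f g = begin
    sumFin (g ∘ Bijection.to f)                                         ≡⟨ sumFin-preimage F (Bijection.injective f) (λ _ → g) ⟨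
    sumFin (λ v → maybe′ (λ _ → g v) 0 (preimage F v))                  ≡⟨ sumFin-cong hit ⟩
    sumFin g                                                            ∎
    where
    open ≡-Reasoning
    F = Bijection.to f
    hit : ∀ v → maybe′ (λ _ → g v) 0 (preimage F v) ≡ g v
    hit v with Bijection.surjective f v
    ... | u , Fu≡v with preimage-complete F u
    ... | j , eq rewrite Fu≡v refl | eq = refl

sumFin-label : ∀ {m} (f : Fin m ⤖ Fin m) → sumFin (label f) + sumFin (label f) ≡ m * suc m
sumFin-label {m} f = trans (cong (λ s → s + s) (sumFin-bijection f (suc ∘ toℕ))) (sumFin-triangular m)

if-then-else-0≡* : ∀ b x → (if b then x else 0) ≡ (if b then 1 else 0) * x
if-then-else-0≡* true  x = sym (+-identityʳ x)
if-then-else-0≡* false x = refl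

sumFin-weight : ∀ {m} (a : Adj m) → (∀ u v → a u v ≡ a v u) → (ℓ : Fin m → ℕ) →
                sumFin (weight a ℓ) ≡ sumFin (λ v → degree a v * ℓ v)
sumFin-weight a a-sym ℓ = trans (sumFin-comm (λ u v → if a u v then ℓ v else 0)) (sumFin-cong column)
  where
  column : ∀ v → sumFin (λ u → if a u v then ℓ v else 0) ≡ degree a v * ℓ v
  column v = begin
    sumFin (λ u → if a u v then ℓ v else 0)            ≡⟨ sumFin-cong (λ u → trans (if-then-else-0≡* (a u v) (ℓ v)) (cong (λ b → (if b then 1 else 0) * ℓ v) (a-sym u v))) ⟩
    sumFin (λ u → (if a v u then 1 else 0) * ℓ v)      ≡⟨ sumFin-*ʳ (λ u → if a v u then 1 else 0) (ℓ v) ⟩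
    degree a v * ℓ v                                   ∎
    where open ≡-Reasoning

weight-shift : ∀ {m} (a : Adj m) (ℓ : Fin m → ℕ) d u → weight a (λ v → ℓ v + d) u ≡ weight a ℓ u + degree a u * d
weight-shift a ℓ d u = begin
  weight a (λ v → ℓ v + d) u                                                  ≡⟨ sumFin-cong split ⟩
  sumFin (λ v → (if a u v then ℓ v else 0) + (if a u v then 1 else 0) * d)    ≡⟨ sumFin-distrib-+ (λ v → if a u v then ℓ v else 0) (λ v → (if a u v then 1 else 0) * d) ⟩
  weight a ℓ u + sumFin (λ v → (if a u v then 1 else 0) * d)                  ≡⟨ cong (weight a ℓ u +_) (sumFin-*ʳ (λ v → if a u v then 1 else 0) d) ⟩
  weight a ℓ u + degree a u * d                                               ∎
  where
  open ≡-Reasoning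
  split : ∀ v → (if a u v then ℓ v + d else 0) ≡ (if a u v then ℓ v else 0) + (if a u v then 1 else 0) * d
  split v with a u v
  ... | true  = cong (ℓ v +_) (sym (+-identityʳ d))
  ... | false = refl

magic-constant : ∀ {m} .{{_ : NonZero m}} n (a : Adj m) → (∀ u v → a u v ≡ a v u) → Regular (n + n) a →
                 (f : Fin m ⤖ Fin m) → ∀ c → (∀ u → weight a (label f) u ≡ c) → c ≡ n * suc m
magic-constant {m} n a a-sym a-reg f c magic = *-cancelˡ-≡ c (n * suc m) m (begin
  m * c                                   ≡⟨ sumFin-const m c ⟨
  sumFin {m} (λ _ → c)                    ≡⟨ sumFin-cong (sym ∘ magic) ⟩
  sumFin (weight a ℓ)                     ≡⟨ sumFin-weight a a-sym ℓ ⟩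
  sumFin (λ v → degree a v * ℓ v)         ≡⟨ sumFin-cong (λ v → trans (cong (_* ℓ v) (a-reg v)) (*-comm (n + n) (ℓ v))) ⟩
  sumFin (λ v → ℓ v * (n + n))            ≡⟨ sumFin-*ʳ ℓ (n + n) ⟩
  sumFin ℓ * (n + n)                      ≡⟨ s*[n+n]≡n*[s+s] (sumFin ℓ) n ⟩
  n * (sumFin ℓ + sumFin ℓ)               ≡⟨ cong (n *_) (sumFin-label f) ⟩
  n * (m * suc m)                         ≡⟨ n*[m*k]≡m*[n*k] n m (suc m) ⟩
  m * (n * suc m)                         ∎)
  where
  open ≡-Reasoning
  ℓ = label f
  s*[n+n]≡n*[s+s] : ∀ s n → s * (n + n) ≡ n * (s + s)
  s*[n+n]≡n*[s+s] = solve-∀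
  n*[m*k]≡m*[n*k] : ∀ n m k → n * (m * k) ≡ m * (n * k)
  n*[m*k]≡m*[n*k] = solve-∀

↑-elim : ∀ {k l} (P : Fin (k + l) → Set) → (∀ i → P (i ↑ˡ l)) → (∀ j → P (k ↑ʳ j)) → ∀ x → P x
↑-elim {k} {l} P left right x = subst P (Fin.join-splitAt k l x) (by-side (splitAt k x))
  where
  by-side : ∀ s → P (join k l s)
  by-side (inj₁ i) = left i
  by-side (inj₂ j) = right j

↑ˡ≢↑ʳ : ∀ {k l} (i : Fin k) (j : Fin l) → i ↑ˡ l ≢ k ↑ʳ j
↑ˡ≢↑ʳ {k} {l} i j eq with () ← trans (sym (Fin.splitAt-↑ˡ k i l)) (trans (cong (splitAt k) eq) (Fin.splitAt-↑ʳ k l j))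

toℕ-≡ᵇ : ∀ {k} (i j : Fin k) → (toℕ i ≡ᵇ toℕ j) ≡ ⌊ i Fin.≟ j ⌋
toℕ-≡ᵇ zero    zero    = refl
toℕ-≡ᵇ zero    (suc j) = refl
toℕ-≡ᵇ (suc i) zero    = refl
toℕ-≡ᵇ (suc i) (suc j) = trans (toℕ-≡ᵇ i j) (sym (⌊⌋-map′ (cong suc) Fin.suc-injective (i Fin.≟ j)))

⌊⌋-⇔ : ∀ {A B : Set} → A ⇔ B → (a? : Dec A) (b? : Dec B) → ⌊ a? ⌋ ≡ ⌊ b? ⌋
⌊⌋-⇔ A⇔B a? b? = trans (isYes≗does a?) (trans (does-⇔ A⇔B a? b?) (sym (isYes≗does b?)))

module Twins (p : ℕ) where

  n = suc p

  twin : Fin (n + n) → Fin (n + n)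
  twin i = join n n (swap (splitAt n i))

  twin-↑ˡ : ∀ a → twin (a ↑ˡ n) ≡ n ↑ʳ a
  twin-↑ˡ a = cong (join n n ∘ swap) (Fin.splitAt-↑ˡ n a n)

  twin-↑ʳ : ∀ a → twin (n ↑ʳ a) ≡ a ↑ˡ n
  twin-↑ʳ a = cong (join n n ∘ swap) (Fin.splitAt-↑ʳ n n a)

  twin-involutive : ∀ i → twin (twin i) ≡ i
  twin-involutive i = begin
    join n n (swap (splitAt n (join n n (swap (splitAt n i)))))  ≡⟨ cong (join n n ∘ swap) (Fin.splitAt-join n n (swap (splitAt n i))) ⟩
    join n n (swap (swap (splitAt n i)))                         ≡⟨ cong (join n n) (swap-involutive (splitAt n i)) ⟩
    join n n (splitAt n i)                                       ≡⟨ Fin.join-splitAt n n i ⟩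
    i                                                            ∎
    where open ≡-Reasoning

  twin-≢ : ∀ i → twin i ≢ i
  twin-≢ = ↑-elim (λ i → twin i ≢ i)
    (λ a eq → ↑ˡ≢↑ʳ a a (sym (trans (sym (twin-↑ˡ a)) eq)))
    (λ a eq → ↑ˡ≢↑ʳ a a (trans (sym (twin-↑ʳ a)) eq))

  toℕ-twin : ∀ i → toℕ (twin i) ≡ (toℕ i + n) % (n + n)
  toℕ-twin = ↑-elim (λ i → toℕ (twin i) ≡ (toℕ i + n) % (n + n)) left right
    where
    open ≡-Reasoning
    left : ∀ a → toℕ (twin (a ↑ˡ n)) ≡ (toℕ (a ↑ˡ n) + n) % (n + n)
    left a = begin
      toℕ (twin (a ↑ˡ n))           ≡⟨ cong toℕ (twin-↑ˡ a) ⟩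
      toℕ (n ↑ʳ a)                  ≡⟨ Fin.toℕ-↑ʳ n a ⟩
      n + toℕ a                     ≡⟨ +-comm n (toℕ a) ⟩
      toℕ a + n                     ≡⟨ m<n⇒m%n≡m (+-monoˡ-< n (Fin.toℕ<n a)) ⟨
      (toℕ a + n) % (n + n)         ≡⟨ cong (λ t → (t + n) % (n + n)) (Fin.toℕ-↑ˡ a n) ⟨
      (toℕ (a ↑ˡ n) + n) % (n + n)  ∎
    right : ∀ a → toℕ (twin (n ↑ʳ a)) ≡ (toℕ (n ↑ʳ a) + n) % (n + n)
    right a = begin
      toℕ (twin (n ↑ʳ a))           ≡⟨ cong toℕ (twin-↑ʳ a) ⟩
      toℕ (a ↑ˡ n)                  ≡⟨ Fin.toℕ-↑ˡ a n ⟩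
      toℕ a                         ≡⟨ m<n⇒m%n≡m (<-≤-trans (Fin.toℕ<n a) (m≤m+n n n)) ⟨
      toℕ a % (n + n)               ≡⟨ [m+n]%n≡m%n (toℕ a) (n + n) ⟨
      (toℕ a + (n + n)) % (n + n)   ≡⟨ cong (_% (n + n)) (x+[n+n]≡n+x+n (toℕ a) n) ⟩
      (n + toℕ a + n) % (n + n)     ≡⟨ cong (λ t → (t + n) % (n + n)) (Fin.toℕ-↑ʳ n a) ⟨
      (toℕ (n ↑ʳ a) + n) % (n + n)  ∎
      where
      x+[n+n]≡n+x+n : ∀ x n → x + (n + n) ≡ n + x + n
      x+[n+n]≡n+x+n = solve-∀

  hAdj-twin : ∀ i j → hAdj n i j ≡ not ⌊ i Fin.≟ j ⌋ ∧ not ⌊ j Fin.≟ twin i ⌋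
  hAdj-twin i j = cong (λ b → not ⌊ i Fin.≟ j ⌋ ∧ not b)
    (trans (cong (toℕ j ≡ᵇ_) (sym (toℕ-twin i))) (toℕ-≡ᵇ j (twin i)))

  hAdj-sym : ∀ i j → hAdj n i j ≡ hAdj n j i
  hAdj-sym i j = begin
    hAdj n i j                                          ≡⟨ hAdj-twin i j ⟩
    not ⌊ i Fin.≟ j ⌋ ∧ not ⌊ j Fin.≟ twin i ⌋          ≡⟨ cong₂ (λ b b′ → not b ∧ not b′) (⌊⌋-⇔ (mk⇔ sym sym) (i Fin.≟ j) (j Fin.≟ i)) (⌊⌋-⇔ twin-swap (j Fin.≟ twin i) (i Fin.≟ twin j)) ⟩
    not ⌊ j Fin.≟ i ⌋ ∧ not ⌊ i Fin.≟ twin j ⌋          ≡⟨ hAdj-twin j i ⟨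
    hAdj n j i                                          ∎
    where
    open ≡-Reasoning
    twin-swap : (j ≡ twin i) ⇔ (i ≡ twin j)
    twin-swap = mk⇔ (λ { refl → sym (twin-involutive i) }) (λ { refl → sym (twin-involutive j) })

  sumFin-hAdj : ∀ i (g : Fin (n + n) → ℕ) →
                sumFin (λ j → if hAdj n i j then g j else 0) + (g i + g (twin i)) ≡ sumFin g
  sumFin-hAdj i g = begin
    sumFin H + (g i + g (twin i))                                   ≡⟨ cong (sumFin H +_) (cong₂ _+_ (sumFin-indicator i g) (sumFin-indicator (twin i) g)) ⟨
    sumFin H + (sumFin (at i) + sumFin (at (twin i)))               ≡⟨ cong (sumFin H +_) (sumFin-distrib-+ (at i) (at (twin i))) ⟨
    sumFin H + sumFin (λ j → at i j + at (twin i) j)                ≡⟨ sumFin-distrib-+ H (λ j → at i j + at (twin i) j) ⟨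
    sumFin (λ j → H j + (at i j + at (twin i) j))                   ≡⟨ sumFin-cong partition ⟩
    sumFin g                                                        ∎
    where
    open ≡-Reasoning
    H : Fin (n + n) → ℕ
    H j = if hAdj n i j then g j else 0
    at : Fin (n + n) → Fin (n + n) → ℕ
    at a j = if ⌊ a Fin.≟ j ⌋ then g j else 0
    partition : ∀ j → H j + (at i j + at (twin i) j) ≡ g j
    partition j rewrite hAdj-twin i j | ⌊⌋-⇔ (mk⇔ sym sym) (twin i Fin.≟ j) (j Fin.≟ twin i)
      with i Fin.≟ j | j Fin.≟ twin i
    ... | yes refl | yes i≡twin-i = contradiction (sym i≡twin-i) (twin-≢ i)
    ... | yes refl | no _         = +-identityʳ _
    ... | no _     | yes _        = refl
    ... | no _     | no _         = +-identityʳ _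

cast-↔ : ∀ {k l} → k ≡ l → Fin k ↔ Fin l
cast-↔ e = mk↔ₛ′ (cast e) (cast (sym e)) (Fin.cast-involutive e (sym e)) (Fin.cast-involutive (sym e) e)

⊎-middle : (A B C : Set) → (A ⊎ (B ⊎ C)) ↔ (B ⊎ (A ⊎ C))
⊎-middle A B C = begin
  (A ⊎ (B ⊎ C))   ↔⟨ ⊎-assoc _ A B C ⟨
  ((A ⊎ B) ⊎ C)   ↔⟨ ⊎-comm A B ⊎-↔ ↔-id C ⟩
  ((B ⊎ A) ⊎ C)   ↔⟨ ⊎-assoc _ B A C ⟩
  (B ⊎ (A ⊎ C))   ∎
  where open EquationalReasoning

shiftedLabeling : ∀ {m} p (f : Fin m ⤖ Fin m) {k} → k ≡ p + p → Fin (m + k) ⤖ Fin (m + k)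
shiftedLabeling {m} p f refl = ↔⇒⤖ (begin
  Fin (m + (p + p))         ↔⟨ Fin.+↔⊎ ⟩
  (Fin m ⊎ Fin (p + p))     ↔⟨ ⤖⇒↔ f ⊎-↔ Fin.+↔⊎ ⟩
  (Fin m ⊎ (Fin p ⊎ Fin p)) ↔⟨ ⊎-middle (Fin m) (Fin p) (Fin p) ⟩
  (Fin p ⊎ (Fin m ⊎ Fin p)) ↔⟨ ↔-id (Fin p) ⊎-↔ Fin.+↔⊎ ⟨
  (Fin p ⊎ Fin (m + p))     ↔⟨ Fin.+↔⊎ ⟨
  Fin (p + (m + p))         ↔⟨ cast-↔ p+[m+p]≡m+[p+p] ⟩
  Fin (m + (p + p))         ∎)
  where
  open EquationalReasoning
  p+[m+p]≡m+[p+p] : p + (m + p) ≡ m + (p + p)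
  p+[m+p]≡m+[p+p] = trans (sym (+-assoc p m p)) (trans (cong (_+ p) (+-comm p m)) (+-assoc m p p))

label-shiftedLabeling-↑ˡ : ∀ {m} p (f : Fin m ⤖ Fin m) {k} (e : k ≡ p + p) u →
                           label (shiftedLabeling p f e) (u ↑ˡ k) ≡ label f u + p
label-shiftedLabeling-↑ˡ {m} p f refl u rewrite Fin.splitAt-↑ˡ m u (p + p) = begin
  suc (toℕ (cast _ (p ↑ʳ (F u ↑ˡ p))))   ≡⟨ cong suc (Fin.toℕ-cast _ (p ↑ʳ (F u ↑ˡ p))) ⟩
  suc (toℕ (p ↑ʳ (F u ↑ˡ p)))            ≡⟨ cong suc (trans (Fin.toℕ-↑ʳ p _) (cong (p +_) (Fin.toℕ-↑ˡ (F u) p))) ⟩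
  suc (p + toℕ (F u))                    ≡⟨ cong suc (+-comm p (toℕ (F u))) ⟩
  suc (toℕ (F u)) + p                    ∎
  where
  open ≡-Reasoning
  F = Bijection.to f

sumFin-label-shiftedLabeling-↑ʳ : ∀ {m} p (f : Fin m ⤖ Fin m) {k} (e : k ≡ p + p) →
  sumFin (λ j → label (shiftedLabeling p f e) (m ↑ʳ j)) ≡ p * suc (m + (p + p))
sumFin-label-shiftedLabeling-↑ʳ {m} p f refl = begin
  sumFin (λ j → ℓ (m ↑ʳ j))                                        ≡⟨ sumFin-↑ p p (λ j → ℓ (m ↑ʳ j)) ⟩
  sumFin (λ a → ℓ (m ↑ʳ (a ↑ˡ p))) + sumFin (λ a → ℓ (m ↑ʳ (p ↑ʳ a)))  ≡⟨ cong₂ _+_ (sumFin-cong low) (sumFin-cong high) ⟩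
  T + sumFin {p} (λ a → (p + m) + suc (toℕ a))                      ≡⟨ cong (T +_) (sumFin-distrib-+ {p} (λ _ → p + m) (suc ∘ toℕ)) ⟩
  T + (sumFin {p} (λ _ → p + m) + T)                                ≡⟨ cong (λ s → T + (s + T)) (sumFin-const p (p + m)) ⟩
  T + (p * (p + m) + T)                                             ≡⟨ t+[s+t]≡[t+t]+s T (p * (p + m)) ⟩
  (T + T) + p * (p + m)                                             ≡⟨ cong (_+ p * (p + m)) (sumFin-triangular p) ⟩
  p * suc p + p * (p + m)                                           ≡⟨ distribute p m ⟩
  p * suc (m + (p + p))                                             ∎
  where
  open ≡-Reasoning
  ℓ = label (shiftedLabeling p f refl)
  T = sumFin {p} (suc ∘ toℕ)
  low : ∀ a → ℓ (m ↑ʳ (a ↑ˡ p)) ≡ suc (toℕ a)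
  low a rewrite Fin.splitAt-↑ʳ m (p + p) (a ↑ˡ p) | Fin.splitAt-↑ˡ p a p =
    cong suc (trans (Fin.toℕ-cast _ (a ↑ˡ (m + p))) (Fin.toℕ-↑ˡ a (m + p)))
  high : ∀ a → ℓ (m ↑ʳ (p ↑ʳ a)) ≡ (p + m) + suc (toℕ a)
  high a rewrite Fin.splitAt-↑ʳ m (p + p) (p ↑ʳ a) | Fin.splitAt-↑ʳ p p a = begin
    suc (toℕ (cast _ (p ↑ʳ (m ↑ʳ a))))   ≡⟨ cong suc (trans (Fin.toℕ-cast _ (p ↑ʳ (m ↑ʳ a))) (trans (Fin.toℕ-↑ʳ p (m ↑ʳ a)) (cong (p +_) (Fin.toℕ-↑ʳ m a)))) ⟩
    suc (p + (m + toℕ a))                ≡⟨ cong suc (+-assoc p m (toℕ a)) ⟨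
    suc (p + m + toℕ a)                  ≡⟨ +-suc (p + m) (toℕ a) ⟨
    p + m + suc (toℕ a)                  ∎
  t+[s+t]≡[t+t]+s : ∀ t s → t + (s + t) ≡ (t + t) + s
  t+[s+t]≡[t+t]+s = solve-∀
  distribute : ∀ p m → p * suc p + p * (p + m) ≡ p * suc (m + (p + p))
  distribute = solve-∀

if-∧-not-split : ∀ b c x → (c ≡ true → b ≡ true) →
                 (if b ∧ not c then x else 0) + (if c then x else 0) ≡ (if b then x else 0)
if-∧-not-split b false x _   = trans (+-identityʳ _) (cong (λ b′ → if b′ then x else 0) (Bool.∧-identityʳ b))
if-∧-not-split b true  x c⇒b rewrite c⇒b refl = refl

w+x≡x+a+b⇒w≡a+b : ∀ w x a b → w + x ≡ x + a + b → w ≡ a + b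
w+x≡x+a+b⇒w≡a+b w x a b eq = +-cancelˡ-≡ x w (a + b) (trans (+-comm x w) (trans eq (+-assoc x a b)))

module Dagger {m : ℕ} (p : ℕ) (G : Adj m) (φ : Fin (suc p + suc p) → Fin m) where

  open Twins p

  k = n + n ∸ 2
  D = dagger n G φ

  dagger-↑ˡ-↑ˡ : ∀ u v → D (u ↑ˡ k) (v ↑ˡ k) ≡ G u v ∧ not (inH n φ u v)
  dagger-↑ˡ-↑ˡ u v rewrite Fin.splitAt-↑ˡ m u k | Fin.splitAt-↑ˡ m v k = refl

  dagger-↑ˡ-↑ʳ : ∀ u j → D (u ↑ˡ k) (m ↑ʳ j) ≡ is-just (preimage φ u)
  dagger-↑ˡ-↑ʳ u j rewrite Fin.splitAt-↑ˡ m u k | Fin.splitAt-↑ʳ m k j = refl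

  dagger-↑ʳ-↑ˡ : ∀ j v → D (m ↑ʳ j) (v ↑ˡ k) ≡ is-just (preimage φ v)
  dagger-↑ʳ-↑ˡ j v rewrite Fin.splitAt-↑ʳ m k j | Fin.splitAt-↑ˡ m v k = refl

  dagger-↑ʳ-↑ʳ : ∀ j j′ → D (m ↑ʳ j) (m ↑ʳ j′) ≡ false
  dagger-↑ʳ-↑ʳ j j′ rewrite Fin.splitAt-↑ʳ m k j | Fin.splitAt-↑ʳ m k j′ = refl

  inH-sym : ∀ u v → inH n φ u v ≡ inH n φ v u
  inH-sym u v with preimage φ u | preimage φ v
  ... | just i  | just j  = hAdj-sym i j
  ... | just _  | nothing = refl
  ... | nothing | just _  = refl
  ... | nothing | nothing = refl

  inH⊆G : (∀ i j → hAdj n i j ≡ true → G (φ i) (φ j) ≡ true) → ∀ u v → inH n φ u v ≡ true → G u v ≡ true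
  inH⊆G H⊆G u v with preimage φ u in eu | preimage φ v in ev
  ... | just i  | just j  = subst₂ (λ a b → G a b ≡ true) (preimage-sound φ eu) (preimage-sound φ ev) ∘ H⊆G i j
  ... | just _  | nothing = λ ()
  ... | nothing | _       = λ ()

  inH-φ : Injective _≡_ _≡_ φ → ∀ i v → inH n φ (φ i) v ≡ maybe′ (hAdj n i) false (preimage φ v)
  inH-φ φ-inj i v rewrite preimage-injective φ φ-inj i with preimage φ v
  ... | just j  = refl
  ... | nothing = refl

  inH-outside : ∀ {u} → preimage φ u ≡ nothing → ∀ v → inH n φ u v ≡ false
  inH-outside {u} eu v with preimage φ u | preimage φ v
  inH-outside refl v | nothing | _ = refl

  weight-dagger-↑ˡ : ∀ (L : Fin (m + k) → ℕ) u → weight D L (u ↑ˡ k) ≡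
    sumFin (λ v → if G u v ∧ not (inH n φ u v) then L (v ↑ˡ k) else 0) +
    (if is-just (preimage φ u) then sumFin (λ j → L (m ↑ʳ j)) else 0)
  weight-dagger-↑ˡ L u = trans (sumFin-↑ m k _) (cong₂ _+_
    (sumFin-cong (λ v → cong (λ b → if b then L (v ↑ˡ k) else 0) (dagger-↑ˡ-↑ˡ u v)))
    (trans (sumFin-cong (λ j → cong (λ b → if b then L (m ↑ʳ j) else 0) (dagger-↑ˡ-↑ʳ u j)))
           (sumFin-if (is-just (preimage φ u)) (λ j → L (m ↑ʳ j)))))

  weight-dagger-↑ʳ : Injective _≡_ _≡_ φ → ∀ (L : Fin (m + k) → ℕ) j → weight D L (m ↑ʳ j) ≡ sumFin (λ i → L (φ i ↑ˡ k))
  weight-dagger-↑ʳ φ-inj L j = begin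
    weight D L (m ↑ʳ j)
      ≡⟨ sumFin-↑ m k _ ⟩
    sumFin (λ v → if D (m ↑ʳ j) (v ↑ˡ k) then L (v ↑ˡ k) else 0) + sumFin (λ j′ → if D (m ↑ʳ j) (m ↑ʳ j′) then L (m ↑ʳ j′) else 0)
      ≡⟨ cong₂ _+_ (sumFin-cong old) (trans (sumFin-cong new) (sumFin-zero k)) ⟩
    sumFin (λ v → maybe′ (λ _ → L (v ↑ˡ k)) 0 (preimage φ v)) + 0
      ≡⟨ +-identityʳ _ ⟩
    sumFin (λ v → maybe′ (λ _ → L (v ↑ˡ k)) 0 (preimage φ v))
      ≡⟨ sumFin-preimage φ φ-inj (λ _ v → L (v ↑ˡ k)) ⟩
    sumFin (λ i → L (φ i ↑ˡ k)) ∎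
    where
    open ≡-Reasoning
    old : ∀ v → (if D (m ↑ʳ j) (v ↑ˡ k) then L (v ↑ˡ k) else 0) ≡ maybe′ (λ _ → L (v ↑ˡ k)) 0 (preimage φ v)
    old v rewrite dagger-↑ʳ-↑ˡ j v with preimage φ v
    ... | just _  = refl
    ... | nothing = refl
    new : ∀ j′ → (if D (m ↑ʳ j) (m ↑ʳ j′) then L (m ↑ʳ j′) else 0) ≡ 0
    new j′ rewrite dagger-↑ʳ-↑ʳ j j′ = refl

  weight-dagger-outside : ∀ {u} → preimage φ u ≡ nothing → ∀ (L : Fin (m + k) → ℕ) →
                          weight D L (u ↑ˡ k) ≡ weight G (λ v → L (v ↑ˡ k)) u
  weight-dagger-outside {u} eu L = begin
    weight D L (u ↑ˡ k)                                                  ≡⟨ weight-dagger-↑ˡ L u ⟩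
    sumFin (λ v → if G u v ∧ not (inH n φ u v) then L (v ↑ˡ k) else 0) +
      (if is-just (preimage φ u) then sumFin (λ j → L (m ↑ʳ j)) else 0)  ≡⟨ cong₂ _+_ (sumFin-cong kept) (cong (λ x → if is-just x then _ else 0) eu) ⟩
    weight G (λ v → L (v ↑ˡ k)) u + 0                                    ≡⟨ +-identityʳ _ ⟩
    weight G (λ v → L (v ↑ˡ k)) u                                        ∎
    where
    open ≡-Reasoning
    kept : ∀ v → (if G u v ∧ not (inH n φ u v) then L (v ↑ˡ k) else 0) ≡ (if G u v then L (v ↑ˡ k) else 0)
    kept v = cong (λ b → if b then L (v ↑ˡ k) else 0)
                  (trans (cong (λ b → G u v ∧ not b) (inH-outside eu v)) (Bool.∧-identityʳ (G u v)))

  -- Σ over H is added on the left so that the removed H-edges need no truncated subtraction.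
  weight-dagger-φ : Injective _≡_ _≡_ φ → (∀ i j → hAdj n i j ≡ true → G (φ i) (φ j) ≡ true) →
    ∀ (L : Fin (m + k) → ℕ) i →
    weight D L (φ i ↑ˡ k) + sumFin (λ j → L (φ j ↑ˡ k)) ≡
    weight G (λ v → L (v ↑ˡ k)) (φ i) + (L (φ i ↑ˡ k) + L (φ (twin i) ↑ˡ k)) + sumFin (λ j → L (m ↑ʳ j))
  weight-dagger-φ φ-inj H⊆G L i = begin
    weight D L (φ i ↑ˡ k) + sumFin (ℓ ∘ φ)   ≡⟨ cong₂ _+_ (weight-dagger-↑ˡ L (φ i)) (sym H-neighbours) ⟩
    (Kept + (if is-just (preimage φ (φ i)) then U else 0)) + (Removed + P)
                                            ≡⟨ cong (λ x → (Kept + (if is-just x then U else 0)) + (Removed + P)) (preimage-injective φ φ-inj i) ⟩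
    (Kept + U) + (Removed + P)              ≡⟨ regroup Kept U Removed P ⟩
    (Kept + Removed) + P + U                ≡⟨ cong (λ x → x + P + U) G-neighbours ⟩
    weight G ℓ (φ i) + P + U                ∎
    where
    open ≡-Reasoning
    ℓ : Fin m → ℕ
    ℓ v = L (v ↑ˡ k)
    Kept Removed P U : ℕ
    Kept = sumFin (λ v → if G (φ i) v ∧ not (inH n φ (φ i) v) then ℓ v else 0)
    Removed = sumFin (λ v → if inH n φ (φ i) v then ℓ v else 0)
    P = ℓ (φ i) + ℓ (φ (twin i))
    U = sumFin (λ j → L (m ↑ʳ j))
    G-neighbours : Kept + Removed ≡ weight G ℓ (φ i)
    G-neighbours = trans (sym (sumFin-distrib-+ {m} _ _))
      (sumFin-cong (λ v → if-∧-not-split (G (φ i) v) (inH n φ (φ i) v) (ℓ v) (inH⊆G H⊆G (φ i) v)))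
    H-neighbours : Removed + P ≡ sumFin (ℓ ∘ φ)
    H-neighbours = trans (cong (_+ P) (trans (sumFin-cong on-H) (sumFin-preimage φ φ-inj (λ j v → if hAdj n i j then ℓ v else 0))))
                         (sumFin-hAdj i (ℓ ∘ φ))
      where
      on-H : ∀ v → (if inH n φ (φ i) v then ℓ v else 0) ≡ maybe′ (λ j → if hAdj n i j then ℓ v else 0) 0 (preimage φ v)
      on-H v rewrite inH-φ φ-inj i v with preimage φ v
      ... | just _  = refl
      ... | nothing = refl
    regroup : ∀ a u r q → (a + u) + (r + q) ≡ (a + r) + q + u
    regroup = solve-∀

  dagger-symmetric : (∀ u v → G u v ≡ G v u) → ∀ x y → D x y ≡ D y x
  dagger-symmetric G-sym = ↑-elim (λ x → ∀ y → D x y ≡ D y x)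
    (λ u → ↑-elim (λ y → D (u ↑ˡ k) y ≡ D y (u ↑ˡ k))
      (λ v → trans (dagger-↑ˡ-↑ˡ u v) (trans (cong₂ (λ b c → b ∧ not c) (G-sym u v) (inH-sym u v)) (sym (dagger-↑ˡ-↑ˡ v u))))
      (λ j → trans (dagger-↑ˡ-↑ʳ u j) (sym (dagger-↑ʳ-↑ˡ j u))))
    (λ j → ↑-elim (λ y → D (m ↑ʳ j) y ≡ D y (m ↑ʳ j))
      (λ v → trans (dagger-↑ʳ-↑ˡ j v) (sym (dagger-↑ˡ-↑ʳ v j)))
      (λ j′ → trans (dagger-↑ʳ-↑ʳ j j′) (sym (dagger-↑ʳ-↑ʳ j′ j))))

  dagger-irreflexive : (∀ u → G u u ≡ false) → ∀ x → D x x ≡ false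
  dagger-irreflexive G-irr = ↑-elim (λ x → D x x ≡ false)
    (λ u → trans (dagger-↑ˡ-↑ˡ u u) (cong (λ b → b ∧ not (inH n φ u u)) (G-irr u)))
    (λ j → dagger-↑ʳ-↑ʳ j j)

  image-elim : (P : Fin m → Set) → (∀ i → P (φ i)) → (∀ u → preimage φ u ≡ nothing → P u) → ∀ u → P u
  image-elim P inside outside u with preimage φ u in eu
  ... | just i  = subst P (preimage-sound φ eu) (inside i)
  ... | nothing = outside u eu

  k≡p+p : k ≡ p + p
  k≡p+p = cong (_∸ 1) (+-suc p p)

  dagger-regular : Injective _≡_ _≡_ φ → (∀ i j → hAdj n i j ≡ true → G (φ i) (φ j) ≡ true) →
                   Regular (n + n) G → Regular (n + n) D
  dagger-regular φ-inj H⊆G G-reg = ↑-elim (λ x → degree D x ≡ n + n)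
    (image-elim (λ u → degree D (u ↑ˡ k) ≡ n + n) on-H (λ u eu → trans (weight-dagger-outside eu (λ _ → 1)) (G-reg u)))
    (λ j → trans (weight-dagger-↑ʳ φ-inj (λ _ → 1) j) (trans (sumFin-const (n + n) 1) (*-identityʳ (n + n))))
    where
    on-H : ∀ i → degree D (φ i ↑ˡ k) ≡ n + n
    on-H i = trans (w+x≡x+a+b⇒w≡a+b _ (n + n) 2 k (begin
      degree D (φ i ↑ˡ k) + (n + n)                         ≡⟨ cong (degree D (φ i ↑ˡ k) +_) (trans (sumFin-const (n + n) 1) (*-identityʳ (n + n))) ⟨
      degree D (φ i ↑ˡ k) + sumFin {n + n} (λ _ → 1)        ≡⟨ weight-dagger-φ φ-inj H⊆G (λ _ → 1) i ⟩
      degree G (φ i) + 2 + sumFin {k} (λ _ → 1)             ≡⟨ cong₂ (λ d u → d + 2 + u) (G-reg (φ i)) (trans (sumFin-const k 1) (*-identityʳ k)) ⟩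
      n + n + 2 + k                                         ∎))
      (trans (cong (2 +_) k≡p+p) (cong suc (sym (+-suc p p))))
      where open ≡-Reasoning

  dagger-magic : Injective _≡_ _≡_ φ → (∀ i j → hAdj n i j ≡ true → G (φ i) (φ j) ≡ true) →
    (∀ u v → G u v ≡ G v u) → Regular (n + n) G → (f : Fin m ⤖ Fin m) → IsDistanceMagicLabeling G f →
    (∀ (a : Fin n) → label f (φ (a ↑ˡ n)) + label f (φ (n ↑ʳ a)) ≡ m + 1) →
    IsDistanceMagicLabeling D (shiftedLabeling p f k≡p+p)
  dagger-magic φ-inj H⊆G G-sym G-reg f (c , f-magic) twins =
    n * s , ↑-elim (λ x → weight D (label g) x ≡ n * s) (image-elim (λ u → weight D (label g) (u ↑ˡ k) ≡ n * s) on-H outside) new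
    where
    open ≡-Reasoning
    s = suc (m + (p + p))
    g = shiftedLabeling p f k≡p+p
    ℓ = label f
    ℓ′ : Fin m → ℕ
    ℓ′ v = label g (v ↑ˡ k)
    shift : ∀ v → ℓ′ v ≡ ℓ v + p
    shift = label-shiftedLabeling-↑ˡ p f k≡p+p
    c≡n[m+1] : c ≡ n * suc m
    c≡n[m+1] = magic-constant {{Fin.nonZeroIndex (φ zero)}} n G G-sym G-reg f c f-magic
    collect : ∀ p m → suc p * suc m + (suc p + suc p) * p ≡ suc p * suc (m + (p + p))
    collect = solve-∀
    twins-paired : ∀ i → ℓ (φ i) + ℓ (φ (twin i)) ≡ m + 1
    twins-paired = ↑-elim (λ i → ℓ (φ i) + ℓ (φ (twin i)) ≡ m + 1)
      (λ a → trans (cong (λ t → ℓ (φ (a ↑ˡ n)) + ℓ (φ t)) (twin-↑ˡ a)) (twins a))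
      (λ a → trans (cong (λ t → ℓ (φ (n ↑ʳ a)) + ℓ (φ t)) (twin-↑ʳ a)) (trans (+-comm (ℓ (φ (n ↑ʳ a))) (ℓ (φ (a ↑ˡ n)))) (twins a)))
    old-weight : ∀ u → weight G ℓ′ u ≡ n * s
    old-weight u = begin
      weight G ℓ′ u                      ≡⟨ sumFin-cong (λ v → cong (λ x → if G u v then x else 0) (shift v)) ⟩
      weight G (λ v → ℓ v + p) u         ≡⟨ weight-shift G ℓ p u ⟩
      weight G ℓ u + degree G u * p      ≡⟨ cong₂ (λ w d → w + d * p) (trans (f-magic u) c≡n[m+1]) (G-reg u) ⟩
      n * suc m + (n + n) * p            ≡⟨ collect p m ⟩
      n * s                              ∎
    H-sum : sumFin (ℓ′ ∘ φ) ≡ n * s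
    H-sum = begin
      sumFin (ℓ′ ∘ φ)                                              ≡⟨ sumFin-cong (shift ∘ φ) ⟩
      sumFin (λ i → ℓ (φ i) + p)                                   ≡⟨ sumFin-distrib-+ (ℓ ∘ φ) (λ _ → p) ⟩
      sumFin (ℓ ∘ φ) + sumFin {n + n} (λ _ → p)                    ≡⟨ cong₂ _+_ (sumFin-↑ n n (ℓ ∘ φ)) (sumFin-const (n + n) p) ⟩
      sumFin {n} (λ a → ℓ (φ (a ↑ˡ n))) + sumFin {n} (λ a → ℓ (φ (n ↑ʳ a))) + (n + n) * p
                                                                   ≡⟨ cong (_+ (n + n) * p) (sumFin-distrib-+ (λ a → ℓ (φ (a ↑ˡ n))) (λ a → ℓ (φ (n ↑ʳ a)))) ⟨
      sumFin {n} (λ a → ℓ (φ (a ↑ˡ n)) + ℓ (φ (n ↑ʳ a))) + (n + n) * p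
                                                                   ≡⟨ cong (_+ (n + n) * p) (trans (sumFin-cong twins) (sumFin-const n (m + 1))) ⟩
      n * (m + 1) + (n + n) * p                                    ≡⟨ cong (λ t → n * t + (n + n) * p) (+-comm m 1) ⟩
      n * suc m + (n + n) * p                                      ≡⟨ collect p m ⟩
      n * s                                                        ∎
    twin-pair : ∀ i → ℓ′ (φ i) + ℓ′ (φ (twin i)) ≡ s
    twin-pair i = begin
      ℓ′ (φ i) + ℓ′ (φ (twin i))                ≡⟨ cong₂ _+_ (shift (φ i)) (shift (φ (twin i))) ⟩
      (ℓ (φ i) + p) + (ℓ (φ (twin i)) + p)      ≡⟨ [a+p]+[b+p]≡[a+b]+[p+p] (ℓ (φ i)) p (ℓ (φ (twin i))) ⟩
      (ℓ (φ i) + ℓ (φ (twin i))) + (p + p)      ≡⟨ cong (_+ (p + p)) (trans (twins-paired i) (+-comm m 1)) ⟩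
      s                                         ∎
      where
      [a+p]+[b+p]≡[a+b]+[p+p] : ∀ a p b → (a + p) + (b + p) ≡ (a + b) + (p + p)
      [a+p]+[b+p]≡[a+b]+[p+p] = solve-∀
    on-H : ∀ i → weight D (label g) (φ i ↑ˡ k) ≡ n * s
    -- s + p * s is n * s by the defining equation of _*_.
    on-H i = w+x≡x+a+b⇒w≡a+b _ (n * s) s (p * s) (begin
      weight D (label g) (φ i ↑ˡ k) + n * s                                  ≡⟨ cong (weight D (label g) (φ i ↑ˡ k) +_) H-sum ⟨
      weight D (label g) (φ i ↑ˡ k) + sumFin (ℓ′ ∘ φ)                        ≡⟨ weight-dagger-φ φ-inj H⊆G (label g) i ⟩
      weight G ℓ′ (φ i) + (ℓ′ (φ i) + ℓ′ (φ (twin i))) + sumFin (λ j → label g (m ↑ʳ j))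
                                                                             ≡⟨ cong₂ _+_ (cong₂ _+_ (old-weight (φ i)) (twin-pair i)) (sumFin-label-shiftedLabeling-↑ʳ p f k≡p+p) ⟩
      n * s + s + p * s                                                      ∎)
    outside : ∀ u → preimage φ u ≡ nothing → weight D (label g) (u ↑ˡ k) ≡ n * s
    outside u eu = trans (weight-dagger-outside eu (label g)) (old-weight u)
    new : ∀ j → weight D (label g) (m ↑ʳ j) ≡ n * s
    new j = trans (weight-dagger-↑ʳ φ-inj (label g) j) H-sum

theorem2p3 : (n m : ℕ) → 1 ≤ n → (G : Adj m) → IsSimple G → Regular (n + n) G →
    (f : Fin m ⤖ Fin m) → IsDistanceMagicLabeling G f →
    (φ : Fin (n + n) → Fin m) → Injective _≡_ _≡_ φ →
    (∀ i j → hAdj n i j ≡ true → G (φ i) (φ j) ≡ true) →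
    (∀ (i : Fin n) → label f (φ (i ↑ˡ n)) + label f (φ (n ↑ʳ i)) ≡ m + 1) →
    IsSimple (dagger n G φ) × Regular (n + n) (dagger n G φ) × DistanceMagic (dagger n G φ)
theorem2p3 (suc p) m (s≤s z≤n) G (G-sym , G-irrefl) G-regular f f-magic φ φ-injective H⊆G twins =
  (dagger-symmetric G-sym , dagger-irreflexive G-irrefl) ,
  dagger-regular φ-injective H⊆G G-regular ,
  (shiftedLabeling p f k≡p+p , dagger-magic φ-injective H⊆G G-sym G-regular f f-magic twins)
  where open Dagger p G φ
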